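{- For all integers $0\le a\le 21$ and $k\ge 0$ with $a+k\ge 1$, one has $\|2^a3^k\|=2a+3k$.
   Context: For a positive integer $n$, its complexity $\|n\|$ is the least number of $1$'s needed to write $n$ using only the constant $1$, addition, multiplication, and parentheses (so $\|1\|=1$ and for $n>1$, $\|n\|=\min\{\|a\|+\|b\|: a,b<n,\ a+b=n \text{ or } ab=n\}$). -}

module Defs where

open import Data.Nat using (ℕ; zero; suc; _+_; _*_; _≤_)
open import Data.Product using (Σ; _×_)
open import Relation.Binary.PropositionalEquality using (_≡_)

data Expr : Set where
  one  : Expr
  _⊕_  : Expr → Expr → Expr
  _⊗_  : Expr → Expr → Expr

val : Expr → ℕ
val one       = 1
val (e ⊕ f)   = val e + val f
val (e ⊗ f)   = val e * val f

ones : Expr → ℕ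
ones one      = 1
ones (e ⊕ f)  = ones e + ones f
ones (e ⊗ f)  = ones e + ones f

-- IsComplexity n c  means  ‖n‖ = c : c is the least number of 1's needed to
-- write n, i.e. some expression of value n uses exactly c ones, and every
-- expression of value n uses at least c ones.
IsComplexity : ℕ → ℕ → Set
IsComplexity n c =
  Σ Expr (λ e → (val e ≡ n) × (ones e ≡ c)) × ((e : Expr) → val e ≡ n → c ≤ ones e)

-- Selfridge's bound n ^ 3 ≤ 3 ^ ‖n‖ settles a ≤ 9 at once: the defect 2a + 3k − 3 log₃ (2 ^ a 3 ^ k) equals
-- a (2 − 3 log₃ 2) ≈ 0.107 a, which is then below 1.  For larger a we induct on an expression for 2 ^ a 3 ^ k.
-- A product splits 2 ^ a 3 ^ k into two numbers of the same shape.  A sum x + y with x, y ≥ 2 costs too much by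
-- Selfridge's bound, as long as a ≤ 21.  A sum 1 + y with fewer than 2a + 3k ones would give y defect below
-- log₃ (7/5), and every value of so small a defect is 2 ^ b 3 ^ j with b ≤ 2; but 1 + 2 ^ b 3 ^ j is never
-- divisible by 8.

{-# OPTIONS --safe #-}
module Submission where

open import Defs
open import Data.Nat using (ℕ; zero; suc; _+_; _*_; _^_; _≤_; _<_; _≤?_; _<?_; z≤n; s≤s; >-nonZero)
open import Data.Nat.Properties
open import Data.Nat.DivMod using (_%_; %-distribˡ-+; %-distribˡ-*; m*n%n≡0)
open import Data.Nat.Divisibility using (divides)
open import Data.Nat.Primality using (Prime; prime?; euclidsLemma; prime⇒nonZero)
open import Data.Nat.Tactic.RingSolver using (solve-∀)
open import Algebra.Properties.CommutativeSemigroup *-commutativeSemigroup using (x∙yz≈y∙xz; interchange)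
open import Data.Product using (Σ; ∃-syntax; _×_; _,_)
open import Data.Sum using (_⊎_; inj₁; inj₂)
open import Data.Empty using (⊥; ⊥-elim)
open import Function using (_∘_)
open import Relation.Nullary using (¬_; yes; no)
open import Relation.Nullary.Decidable using (from-yes; from-no; _→-dec_)
open import Relation.Binary.PropositionalEquality using (_≡_; _≢_; refl; sym; trans; cong; cong₂; subst; subst₂)

open ≤-Reasoning

m+d≡n⇒m≤n : ∀ {m n} d → m + d ≡ n → m ≤ n
m+d≡n⇒m≤n {m} d refl = m≤m+n m d

m*[1+n]≤[1+m]*n : ∀ m {n} → m ≤ n → m * (1 + n) ≤ suc m * n
m*[1+n]≤[1+m]*n m {n} m≤n = begin
  m * (1 + n)  ≡⟨ *-suc m n ⟩
  m + m * n    ≤⟨ +-monoˡ-≤ (m * n) m≤n ⟩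
  suc m * n    ∎

^-distribʳ-* : ∀ m n o → (m * n) ^ o ≡ m ^ o * n ^ o
^-distribʳ-* m n zero    = refl
^-distribʳ-* m n (suc o) = trans (cong (m * n *_) (^-distribʳ-* m n o)) (interchange m n (m ^ o) (n ^ o))

*-cube-mono-≤ : ∀ m u n v → m * u ≤ n * v → m ^ 3 * u ^ 3 ≤ n ^ 3 * v ^ 3
*-cube-mono-≤ m u n v le = subst₂ _≤_ (^-distribʳ-* m u 3) (^-distribʳ-* n v 3) (^-monoˡ-≤ 3 le)

*≤3^+ : ∀ {A B} c d → A ≤ 3 ^ c → B ≤ 3 ^ d → A * B ≤ 3 ^ (c + d)
*≤3^+ c d A≤ B≤ = ≤-trans (*-mono-≤ A≤ B≤) (≤-reflexive (sym (^-distribˡ-+-* 3 c d)))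

8≤3^⇒9≤3^ : ∀ c → 8 ≤ 3 ^ c → 9 ≤ 3 ^ c
8≤3^⇒9≤3^ zero          (s≤s ())
8≤3^⇒9≤3^ (suc zero)    (s≤s (s≤s (s≤s ())))
8≤3^⇒9≤3^ (suc (suc c)) _ = *-monoʳ-≤ 3 (*-monoʳ-≤ 3 (m^n>0 3 c))

^-swap : ∀ m a b → (m ^ a) ^ b ≡ (m ^ b) ^ a
^-swap m a b = begin-equality
  (m ^ a) ^ b  ≡⟨ ^-*-assoc m a b ⟩
  m ^ (a * b)  ≡⟨ cong (m ^_) (*-comm a b) ⟩
  m ^ (b * a)  ≡⟨ ^-*-assoc m b a ⟨
  (m ^ b) ^ a  ∎

cube-2^a3^k : ∀ a k → (2 ^ a * 3 ^ k) ^ 3 ≡ 8 ^ a * 27 ^ k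
cube-2^a3^k a k = trans (^-distribʳ-* (2 ^ a) (3 ^ k) 3) (cong₂ _*_ (^-swap 2 a 3) (^-swap 3 k 3))

3^[2a+3k] : ∀ a k → 3 ^ (2 * a + 3 * k) ≡ 9 ^ a * 27 ^ k
3^[2a+3k] a k = trans (^-distribˡ-+-* 3 (2 * a) (3 * k))
  (cong₂ _*_ (sym (^-*-assoc 3 2 a)) (sym (^-*-assoc 3 3 k)))

64≤2^a3^k : ∀ {a} k → 6 ≤ a → 64 ≤ 2 ^ a * 3 ^ k
64≤2^a3^k {a} k 6≤a = ≤-trans (^-monoʳ-≤ 2 6≤a) (m≤m*n (2 ^ a) (3 ^ k) {{m^n≢0 3 k}})

2^b3^j-* : ∀ b₁ j₁ b₂ j₂ → (2 ^ b₁ * 3 ^ j₁) * (2 ^ b₂ * 3 ^ j₂) ≡ 2 ^ (b₁ + b₂) * 3 ^ (j₁ + j₂)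
2^b3^j-* b₁ j₁ b₂ j₂ = begin-equality
  (2 ^ b₁ * 3 ^ j₁) * (2 ^ b₂ * 3 ^ j₂)  ≡⟨ interchange (2 ^ b₁) (3 ^ j₁) (2 ^ b₂) (3 ^ j₂) ⟩
  (2 ^ b₁ * 2 ^ b₂) * (3 ^ j₁ * 3 ^ j₂)  ≡⟨ cong₂ _*_ (^-distribˡ-+-* 2 b₁ b₂) (^-distribˡ-+-* 3 j₁ j₂) ⟨
  2 ^ (b₁ + b₂) * 3 ^ (j₁ + j₂)          ∎

cube-below-3^ : ∀ a k {c} r s → r * (2 ^ a * 3 ^ k) ^ 3 ≤ s * 3 ^ c → c < 2 * a + 3 * k →
                3 * r * 8 ^ a ≤ s * 9 ^ a
cube-below-3^ a k {c} r s le c< = *-cancelʳ-≤ (3 * r * 8 ^ a) (s * 9 ^ a) (27 ^ k) {{m^n≢0 27 k}} (begin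
  3 * r * 8 ^ a * 27 ^ k          ≡⟨ trans (*-assoc (3 * r) (8 ^ a) (27 ^ k)) (*-assoc 3 r (8 ^ a * 27 ^ k)) ⟩
  3 * (r * (8 ^ a * 27 ^ k))      ≡⟨ cong (λ n → 3 * (r * n)) (cube-2^a3^k a k) ⟨
  3 * (r * (2 ^ a * 3 ^ k) ^ 3)   ≤⟨ *-monoʳ-≤ 3 le ⟩
  3 * (s * 3 ^ c)                 ≡⟨ x∙yz≈y∙xz 3 s (3 ^ c) ⟩
  s * 3 ^ suc c                   ≤⟨ *-monoʳ-≤ s (^-monoʳ-≤ 3 c<) ⟩
  s * 3 ^ (2 * a + 3 * k)         ≡⟨ cong (s *_) (3^[2a+3k] a k) ⟩
  s * (9 ^ a * 27 ^ k)            ≡⟨ *-assoc s (9 ^ a) (27 ^ k) ⟨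
  s * 9 ^ a * 27 ^ k              ∎)

1≤val : ∀ e → 1 ≤ val e
1≤val one     = ≤-refl
1≤val (e ⊕ f) = ≤-trans (1≤val e) (m≤m+n (val e) (val f))
1≤val (e ⊗ f) = *-mono-≤ (1≤val e) (1≤val f)

1≤ones : ∀ e → 1 ≤ ones e
1≤ones one     = ≤-refl
1≤ones (e ⊕ f) = ≤-trans (1≤ones e) (m≤m+n (ones e) (ones f))
1≤ones (e ⊗ f) = ≤-trans (1≤ones e) (m≤m+n (ones e) (ones f))

m+n≤m*n : ∀ {m n} → 2 ≤ m → 2 ≤ n → m + n ≤ m * n
m+n≤m*n {suc (suc p)} {suc (suc q)} (s≤s (s≤s z≤n)) (s≤s (s≤s z≤n)) = m+d≡n⇒m≤n (p + q + p * q) (identity p q)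
  where
  identity : ∀ p q → (2 + p) + (2 + q) + (p + q + p * q) ≡ (2 + p) * (2 + q)
  identity = solve-∀

cube-1+≤3*3^ : ∀ {y d} → 1 ≤ y → 1 ≤ d → y ^ 3 ≤ 3 ^ d → (1 + y) ^ 3 ≤ 3 * 3 ^ d
cube-1+≤3*3^ {1}           {d}     _ 1≤d _  = ≤-trans (n≤1+n 8) (*-monoʳ-≤ 3 (^-monoʳ-≤ 3 {1} {d} 1≤d))
cube-1+≤3*3^ {2}           {d}     _ _   y³≤ = *-monoʳ-≤ 3 (8≤3^⇒9≤3^ d y³≤)
cube-1+≤3*3^ {y@(suc (suc (suc _)))} {d} _ _ y³≤ = *-cancelˡ-≤ 27 (begin
  3 ^ 3 * (1 + y) ^ 3  ≤⟨ *-cube-mono-≤ 3 (1 + y) 4 y (m*[1+n]≤[1+m]*n 3 (s≤s (s≤s (s≤s z≤n)))) ⟩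
  4 ^ 3 * y ^ 3        ≤⟨ *-mono-≤ (m≤m+n 64 17) y³≤ ⟩
  81 * 3 ^ d           ≡⟨ *-assoc 27 3 (3 ^ d) ⟩
  27 * (3 * 3 ^ d)     ∎)

cube-+≤3^+ : ∀ {x y c d} → 1 ≤ x → 1 ≤ y → 1 ≤ c → 1 ≤ d → x ^ 3 ≤ 3 ^ c → y ^ 3 ≤ 3 ^ d →
             (x + y) ^ 3 ≤ 3 ^ (c + d)
cube-+≤3^+ {zero}          () _ _ _ _ _
cube-+≤3^+ {suc zero} {c = c} {d} _ 1≤y 1≤c 1≤d _ y³≤ =
  ≤-trans (cube-1+≤3*3^ 1≤y 1≤d y³≤) (*≤3^+ c d (^-monoʳ-≤ 3 1≤c) ≤-refl)
cube-+≤3^+ {suc (suc _)} {zero} _ () _ _ _ _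
cube-+≤3^+ {x@(suc (suc _))} {suc zero} {c} {d} 1≤x _ 1≤c 1≤d x³≤ _ =
  subst₂ (λ s t → s ^ 3 ≤ 3 ^ t) (+-comm 1 x) (+-comm d c)
    (≤-trans (cube-1+≤3*3^ 1≤x 1≤c x³≤) (*≤3^+ d c (^-monoʳ-≤ 3 1≤d) ≤-refl))
cube-+≤3^+ {x@(suc (suc _))} {y@(suc (suc _))} {c} {d} _ _ _ _ x³≤ y³≤ = begin
  (x + y) ^ 3     ≤⟨ ^-monoˡ-≤ 3 (m+n≤m*n {x} {y} (s≤s (s≤s z≤n)) (s≤s (s≤s z≤n))) ⟩
  (x * y) ^ 3     ≡⟨ ^-distribʳ-* x y 3 ⟩
  x ^ 3 * y ^ 3   ≤⟨ *≤3^+ c d x³≤ y³≤ ⟩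
  3 ^ (c + d)     ∎

val³≤3^ones : ∀ e → val e ^ 3 ≤ 3 ^ ones e
val³≤3^ones one     = s≤s z≤n
val³≤3^ones (e ⊕ f) = cube-+≤3^+ (1≤val e) (1≤val f) (1≤ones e) (1≤ones f) (val³≤3^ones e) (val³≤3^ones f)
val³≤3^ones (e ⊗ f) = begin
  (val e * val f) ^ 3      ≡⟨ ^-distribʳ-* (val e) (val f) 3 ⟩
  val e ^ 3 * val f ^ 3    ≤⟨ *≤3^+ (ones e) (ones f) (val³≤3^ones e) (val³≤3^ones f) ⟩
  3 ^ (ones e + ones f)    ∎

9^a<3*8^a : ∀ {a} → a < 10 → 9 ^ a < 3 * 8 ^ a
9^a<3*8^a = from-yes (allUpTo? (λ a → 9 ^ a <? 3 * 8 ^ a) 10)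

ones-lower-small : ∀ e a k → a ≤ 9 → val e ≡ 2 ^ a * 3 ^ k → 2 * a + 3 * k ≤ ones e
ones-lower-small e a k a≤9 hv = ≮⇒≥ λ ones< →
  <⇒≱ (9^a<3*8^a (s≤s a≤9)) (≤-trans (cube-below-3^ a k 1 1 (*-monoʳ-≤ 1 cube≤) ones<) (≤-reflexive (*-identityˡ (9 ^ a))))
  where
  cube≤ : (2 ^ a * 3 ^ k) ^ 3 ≤ 3 ^ ones e
  cube≤ = subst (λ n → n ^ 3 ≤ 3 ^ ones e) hv (val³≤3^ones e)

-- 5 · 3 ^ c ≤ 7 · n ^ 3 says that writing n with c ones has defect c − 3 log₃ n at most log₃ (7/5) ≈ 0.306.
LowDefect : ℕ → ℕ → Set
LowDefect n c = 5 * 3 ^ c ≤ 7 * n ^ 3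

Is2^≤2·3^ : ℕ → Set
Is2^≤2·3^ n = ∃[ b ] ∃[ j ] b ≤ 2 × n ≡ 2 ^ b * 3 ^ j

lowDefect-scale : ∀ {w z c} A m n → 1 ≤ z → A * z ^ 3 ≤ 3 ^ c → LowDefect w c →
                  m * w ≤ n * z → 5 * A * m ^ 3 ≤ 7 * n ^ 3
lowDefect-scale {w} {z} {c} A m n 1≤z Az³≤ low mw≤nz =
  *-cancelʳ-≤ (5 * A * m ^ 3) (7 * n ^ 3) (z ^ 3) {{m^n≢0 z 3 {{>-nonZero 1≤z}}}} (begin
    5 * A * m ^ 3 * z ^ 3      ≡⟨ regroup 5 A (m ^ 3) (z ^ 3) ⟩
    m ^ 3 * (5 * (A * z ^ 3))  ≤⟨ *-monoʳ-≤ (m ^ 3) (*-monoʳ-≤ 5 Az³≤) ⟩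
    m ^ 3 * (5 * 3 ^ c)        ≤⟨ *-monoʳ-≤ (m ^ 3) low ⟩
    m ^ 3 * (7 * w ^ 3)        ≡⟨ x∙yz≈y∙xz (m ^ 3) 7 (w ^ 3) ⟩
    7 * (m ^ 3 * w ^ 3)        ≤⟨ *-monoʳ-≤ 7 (*-cube-mono-≤ m w n z mw≤nz) ⟩
    7 * (n ^ 3 * z ^ 3)        ≡⟨ *-assoc 7 (n ^ 3) (z ^ 3) ⟨
    7 * n ^ 3 * z ^ 3          ∎)
  where
  regroup : ∀ p q r s → p * q * r * s ≡ r * (p * (q * s))
  regroup = solve-∀

lowDefect-1+ : ∀ {y c d} → 1 ≤ c → y ^ 3 ≤ 3 ^ d → LowDefect (1 + y) (c + d) → Is2^≤2·3^ (1 + y)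
lowDefect-1+ {0} _ _ _ = 0 , 0 , z≤n , refl
lowDefect-1+ {1} _ _ _ = 1 , 0 , s≤s z≤n , refl
lowDefect-1+ {2} _ _ _ = 0 , 1 , z≤n , refl
lowDefect-1+ {3} _ _ _ = 2 , 0 , s≤s (s≤s z≤n) , refl
lowDefect-1+ {y@(suc (suc (suc (suc _))))} {c} {d} 1≤c y³≤ low = ⊥-elim (from-no (5 * 3 * 4 ^ 3 ≤? 7 * 5 ^ 3)
  (lowDefect-scale {1 + y} {y} {c + d} 3 4 5 (s≤s z≤n) (*≤3^+ c d (^-monoʳ-≤ 3 1≤c) y³≤) low (m*[1+n]≤[1+m]*n 4 (s≤s (s≤s (s≤s (s≤s z≤n)))))))

lowDefect-2+ : ∀ {y c d} → 8 ≤ 3 ^ c → y ^ 3 ≤ 3 ^ d → LowDefect (2 + y) (c + d) → Is2^≤2·3^ (2 + y)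
lowDefect-2+ {0} _ _ _ = 1 , 0 , s≤s z≤n , refl
lowDefect-2+ {1} _ _ _ = 0 , 1 , z≤n , refl
lowDefect-2+ {2} _ _ _ = 2 , 0 , s≤s (s≤s z≤n) , refl
lowDefect-2+ {y@(suc (suc (suc q)))} {c} {d} 8≤3^c y³≤ low = ⊥-elim (from-no (5 * 9 * 3 ^ 3 ≤? 7 * 5 ^ 3)
  (lowDefect-scale {2 + y} {y} {c + d} 9 3 5 (s≤s z≤n) (*≤3^+ c d (8≤3^⇒9≤3^ c 8≤3^c) y³≤) low (m+d≡n⇒m≤n (q + q) (identity q))))
  where
  identity : ∀ q → 3 * (2 + (3 + q)) + (q + q) ≡ 5 * (3 + q)
  identity = solve-∀

lowDefect-3+3+ : ∀ {x y c d} → 3 ≤ x → 3 ≤ y → x ^ 3 ≤ 3 ^ c → y ^ 3 ≤ 3 ^ d → ¬ LowDefect (x + y) (c + d)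
lowDefect-3+3+ {x@(suc (suc (suc p)))} {y@(suc (suc (suc q)))} {c} {d} (s≤s (s≤s (s≤s z≤n))) (s≤s (s≤s (s≤s z≤n))) x³≤ y³≤ low =
  from-no (5 * 1 * 3 ^ 3 ≤? 7 * 2 ^ 3)
    (lowDefect-scale {x + y} {x * y} {c + d} 1 3 2 (s≤s z≤n) xy³≤ low (m+d≡n⇒m≤n (3 * p + 3 * q + 2 * (p * q)) (identity p q)))
  where
  identity : ∀ p q → 3 * ((3 + p) + (3 + q)) + (3 * p + 3 * q + 2 * (p * q)) ≡ 2 * ((3 + p) * (3 + q))
  identity = solve-∀
  xy³≤ : 1 * (x * y) ^ 3 ≤ 3 ^ (c + d)
  xy³≤ = begin
    1 * (x * y) ^ 3   ≡⟨ *-identityˡ _ ⟩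
    (x * y) ^ 3       ≡⟨ ^-distribʳ-* x y 3 ⟩
    x ^ 3 * y ^ 3     ≤⟨ *≤3^+ c d x³≤ y³≤ ⟩
    3 ^ (c + d)       ∎

lowDefect-+ : ∀ {x y c d} → 1 ≤ x → 1 ≤ y → 1 ≤ c → 1 ≤ d → x ^ 3 ≤ 3 ^ c → y ^ 3 ≤ 3 ^ d →
              LowDefect (x + y) (c + d) → Is2^≤2·3^ (x + y)
lowDefect-+ {zero} () _ _ _ _ _ _
lowDefect-+ {1} {y} {c} {d} _ _ 1≤c _ _ y³≤ low = lowDefect-1+ {y} {c} {d} 1≤c y³≤ low
lowDefect-+ {2} {y} {c} {d} _ _ _ _ x³≤ y³≤ low = lowDefect-2+ {y} {c} {d} x³≤ y³≤ low
lowDefect-+ {suc (suc (suc _))} {zero} _ () _ _ _ _ _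
lowDefect-+ {x@(suc (suc (suc _)))} {1} {c} {d} _ _ _ 1≤d x³≤ _ low =
  subst Is2^≤2·3^ (+-comm 1 x) (lowDefect-1+ {x} {d} {c} 1≤d x³≤ (subst₂ LowDefect (+-comm x 1) (+-comm c d) low))
lowDefect-+ {x@(suc (suc (suc _)))} {2} {c} {d} _ _ _ _ x³≤ y³≤ low =
  subst Is2^≤2·3^ (+-comm 2 x) (lowDefect-2+ {x} {d} {c} y³≤ x³≤ (subst₂ LowDefect (+-comm x 2) (+-comm c d) low))
lowDefect-+ {x@(suc (suc (suc _)))} {y@(suc (suc (suc _)))} {c} {d} _ _ _ _ x³≤ y³≤ low =
  ⊥-elim (lowDefect-3+3+ {x} {y} {c} {d} (s≤s (s≤s (s≤s z≤n))) (s≤s (s≤s (s≤s z≤n))) x³≤ y³≤ low)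

lowDefect-*ˡ : ∀ {x y c d} → y ^ 3 ≤ 3 ^ d → LowDefect (x * y) (c + d) → LowDefect x c
lowDefect-*ˡ {x} {y} {c} {d} y³≤ low = *-cancelʳ-≤ (5 * 3 ^ c) (7 * x ^ 3) (3 ^ d) {{m^n≢0 3 d}} (begin
  5 * 3 ^ c * 3 ^ d      ≡⟨ *-assoc 5 (3 ^ c) (3 ^ d) ⟩
  5 * (3 ^ c * 3 ^ d)    ≡⟨ cong (5 *_) (^-distribˡ-+-* 3 c d) ⟨
  5 * 3 ^ (c + d)        ≤⟨ low ⟩
  7 * (x * y) ^ 3        ≡⟨ cong (7 *_) (^-distribʳ-* x y 3) ⟩
  7 * (x ^ 3 * y ^ 3)    ≡⟨ *-assoc 7 (x ^ 3) (y ^ 3) ⟨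
  7 * x ^ 3 * y ^ 3      ≤⟨ *-monoʳ-≤ (7 * x ^ 3) y³≤ ⟩
  7 * x ^ 3 * 3 ^ d      ∎)

lowDefect-*ʳ : ∀ {x y c d} → x ^ 3 ≤ 3 ^ c → LowDefect (x * y) (c + d) → LowDefect y d
lowDefect-*ʳ {x} {y} {c} {d} x³≤ low = lowDefect-*ˡ {y} {x} {d} {c} x³≤ (subst₂ LowDefect (*-comm x y) (+-comm c d) low)

7*8^b<5*9^b : ∀ {b} → b < 10 → 2 < b → 7 * 8 ^ b < 5 * 9 ^ b
7*8^b<5*9^b = from-yes (allUpTo? (λ b → 2 <? b →-dec 7 * 8 ^ b <? 5 * 9 ^ b) 10)

lowDefect-2^b3^j⇒b≤2 : ∀ e {b j} → b ≤ 9 → val e ≡ 2 ^ b * 3 ^ j → LowDefect (val e) (ones e) → b ≤ 2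
lowDefect-2^b3^j⇒b≤2 e {b} {j} b≤9 hv low = ≮⇒≥ λ 2<b → <⇒≱ (7*8^b<5*9^b (s≤s b≤9) 2<b)
  (*-cancelʳ-≤ (5 * 9 ^ b) (7 * 8 ^ b) (27 ^ j) {{m^n≢0 27 j}} (begin
    5 * 9 ^ b * 27 ^ j          ≡⟨ *-assoc 5 (9 ^ b) (27 ^ j) ⟩
    5 * (9 ^ b * 27 ^ j)        ≡⟨ cong (5 *_) (3^[2a+3k] b j) ⟨
    5 * 3 ^ (2 * b + 3 * j)     ≤⟨ *-monoʳ-≤ 5 (^-monoʳ-≤ 3 (ones-lower-small e b j b≤9 hv)) ⟩
    5 * 3 ^ ones e              ≤⟨ low ⟩
    7 * val e ^ 3               ≡⟨ cong (λ n → 7 * n ^ 3) hv ⟩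
    7 * (2 ^ b * 3 ^ j) ^ 3     ≡⟨ cong (7 *_) (cube-2^a3^k b j) ⟩
    7 * (8 ^ b * 27 ^ j)        ≡⟨ *-assoc 7 (8 ^ b) (27 ^ j) ⟨
    7 * 8 ^ b * 27 ^ j          ∎))

lowDefect⇒2^≤2·3^ : ∀ e → LowDefect (val e) (ones e) → Is2^≤2·3^ (val e)
lowDefect⇒2^≤2·3^ one _ = 0 , 0 , z≤n , refl
lowDefect⇒2^≤2·3^ (e ⊕ f) low =
  lowDefect-+ (1≤val e) (1≤val f) (1≤ones e) (1≤ones f) (val³≤3^ones e) (val³≤3^ones f) low
lowDefect⇒2^≤2·3^ (e ⊗ f) low
  with lowDefect⇒2^≤2·3^ e (lowDefect-*ˡ {val e} {val f} {ones e} (val³≤3^ones f) low)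
     | lowDefect⇒2^≤2·3^ f (lowDefect-*ʳ {val e} {val f} {ones e} (val³≤3^ones e) low)
... | b₁ , j₁ , b₁≤2 , hv₁ | b₂ , j₂ , b₂≤2 , hv₂ =
  b₁ + b₂ , j₁ + j₂ , lowDefect-2^b3^j⇒b≤2 (e ⊗ f) {j = j₁ + j₂} b≤9 hv low , hv
  where
  hv : val e * val f ≡ 2 ^ (b₁ + b₂) * 3 ^ (j₁ + j₂)
  hv = trans (cong₂ _*_ hv₁ hv₂) (2^b3^j-* b₁ j₁ b₂ j₂)
  b≤9 : b₁ + b₂ ≤ 9
  b≤9 = ≤-trans (+-mono-≤ b₁≤2 b₂≤2) (m≤m+n 4 5)

record Summand (x c : ℕ) : Set where
  field
    positive      : 1 ≤ x
    cost-positive : 1 ≤ c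
    selfridge     : x ^ 3 ≤ 3 ^ c
    classified    : LowDefect x c → Is2^≤2·3^ x

summand : ∀ e → Summand (val e) (ones e)
summand e = record
  { positive      = 1≤val e
  ; cost-positive = 1≤ones e
  ; selfridge     = val³≤3^ones e
  ; classified    = lowDefect⇒2^≤2·3^ e
  }

3^j%8≡1∨3 : ∀ j → 3 ^ j % 8 ≡ 1 ⊎ 3 ^ j % 8 ≡ 3
3^j%8≡1∨3 zero = inj₁ refl
3^j%8≡1∨3 (suc j) with 3^j%8≡1∨3 j
... | inj₁ r = inj₂ (trans (%-distribˡ-* 3 (3 ^ j) 8) (cong (λ t → (3 * t) % 8) r))
... | inj₂ r = inj₁ (trans (%-distribˡ-* 3 (3 ^ j) 8) (cong (λ t → (3 * t) % 8) r))

-- Numbers 2 ^ b 3 ^ j with b ≤ 2 are 1, 2, 3, 4 or 6 modulo 8, so none is one less than a multiple of 8.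
1+2^≤2·3^%8≢0 : ∀ {n} → Is2^≤2·3^ n → (1 + n) % 8 ≢ 0
1+2^≤2·3^%8≢0 (b , j , b≤2 , refl) = nonzero b≤2 (3^j%8≡1∨3 j) ∘ trans (sym residues)
  where
  residues : (1 + 2 ^ b * 3 ^ j) % 8 ≡ (1 + (2 ^ b % 8 * (3 ^ j % 8)) % 8) % 8
  residues = trans (%-distribˡ-+ 1 (2 ^ b * 3 ^ j) 8) (cong (λ t → (1 + t) % 8) (%-distribˡ-* (2 ^ b) (3 ^ j) 8))
  nonzero : ∀ {b r} → b ≤ 2 → r ≡ 1 ⊎ r ≡ 3 → (1 + (2 ^ b % 8 * r) % 8) % 8 ≢ 0
  nonzero z≤n             (inj₁ refl) ()
  nonzero z≤n             (inj₂ refl) ()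
  nonzero (s≤s z≤n)       (inj₁ refl) ()
  nonzero (s≤s z≤n)       (inj₂ refl) ()
  nonzero (s≤s (s≤s z≤n)) (inj₁ refl) ()
  nonzero (s≤s (s≤s z≤n)) (inj₂ refl) ()

2^a3^k%8≡0 : ∀ {a} k → 3 ≤ a → (2 ^ a * 3 ^ k) % 8 ≡ 0
2^a3^k%8≡0 {suc (suc (suc a))} k (s≤s (s≤s (s≤s z≤n))) =
  trans (cong (_% 8) (factor-8 (2 ^ a) (3 ^ k))) (m*n%n≡0 (2 ^ a * 3 ^ k) 8)
  where
  factor-8 : ∀ u v → 2 * (2 * (2 * u)) * v ≡ u * v * 8
  factor-8 = solve-∀

1+2^≤2·3^≢2^a3^k : ∀ {n a} k → Is2^≤2·3^ n → 3 ≤ a → 1 + n ≢ 2 ^ a * 3 ^ k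
1+2^≤2·3^≢2^a3^k k form 3≤a eq = 1+2^≤2·3^%8≢0 form (trans (cong (_% 8) eq) (2^a3^k%8≡0 k 3≤a))

64^3*[5*9^a]≤63^4*8^a : ∀ {a} → a < 22 → 64 ^ 3 * (5 * 9 ^ a) ≤ 63 ^ 4 * 8 ^ a
64^3*[5*9^a]≤63^4*8^a = from-yes (allUpTo? (λ a → 64 ^ 3 * (5 * 9 ^ a) ≤? 63 ^ 4 * 8 ^ a) 22)

-- The two spare ones buy a factor 9, which pays for the defect a (2 − 3 log₃ 2) of 2 ^ a 3 ^ k while a ≤ 21
-- and for the loss (63/64) ^ 3 in replacing 1 + y by y.
lowDefect-pred : ∀ a k {y c} → 6 ≤ a → a ≤ 21 → 1 + y ≡ 2 ^ a * 3 ^ k → 2 + c ≤ 2 * a + 3 * k → LowDefect y c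
lowDefect-pred a k {y} {c} 6≤a a≤21 hv 2+c≤ = *-cancelˡ-≤ (64 ^ 3 * 9) (begin
  64 ^ 3 * 9 * (5 * 3 ^ c)          ≡⟨ *-assoc (64 ^ 3) 9 (5 * 3 ^ c) ⟩
  64 ^ 3 * (9 * (5 * 3 ^ c))        ≤⟨ *-monoʳ-≤ (64 ^ 3) cost-bound ⟩
  64 ^ 3 * (5 * 9 ^ a * 27 ^ k)     ≡⟨ *-assoc (64 ^ 3) (5 * 9 ^ a) (27 ^ k) ⟨
  64 ^ 3 * (5 * 9 ^ a) * 27 ^ k     ≤⟨ *-monoˡ-≤ (27 ^ k) (64^3*[5*9^a]≤63^4*8^a (s≤s a≤21)) ⟩
  63 ^ 4 * 8 ^ a * 27 ^ k           ≡⟨ trans (*-assoc (63 ^ 4) (8 ^ a) (27 ^ k)) (*-assoc 63 (63 ^ 3) (8 ^ a * 27 ^ k)) ⟩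
  63 * (63 ^ 3 * (8 ^ a * 27 ^ k))  ≤⟨ *-monoʳ-≤ 63 value-bound ⟩
  63 * (64 ^ 3 * y ^ 3)             ≡⟨ x∙yz≈y∙xz 63 (64 ^ 3) (y ^ 3) ⟩
  64 ^ 3 * (9 * 7 * y ^ 3)          ≡⟨ cong (64 ^ 3 *_) (*-assoc 9 7 (y ^ 3)) ⟩
  64 ^ 3 * (9 * (7 * y ^ 3))        ≡⟨ *-assoc (64 ^ 3) 9 (7 * y ^ 3) ⟨
  64 ^ 3 * 9 * (7 * y ^ 3)          ∎)
  where
  cost-bound : 9 * (5 * 3 ^ c) ≤ 5 * 9 ^ a * 27 ^ k
  cost-bound = begin
    9 * (5 * 3 ^ c)           ≡⟨ x∙yz≈y∙xz 9 5 (3 ^ c) ⟩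
    5 * (3 * 3 * 3 ^ c)       ≡⟨ cong (5 *_) (*-assoc 3 3 (3 ^ c)) ⟩
    5 * 3 ^ (2 + c)           ≤⟨ *-monoʳ-≤ 5 (^-monoʳ-≤ 3 2+c≤) ⟩
    5 * 3 ^ (2 * a + 3 * k)   ≡⟨ cong (5 *_) (3^[2a+3k] a k) ⟩
    5 * (9 ^ a * 27 ^ k)      ≡⟨ *-assoc 5 (9 ^ a) (27 ^ k) ⟨
    5 * 9 ^ a * 27 ^ k        ∎
  value-bound : 63 ^ 3 * (8 ^ a * 27 ^ k) ≤ 64 ^ 3 * y ^ 3
  value-bound = begin
    63 ^ 3 * (8 ^ a * 27 ^ k)   ≡⟨ cong (63 ^ 3 *_) (trans (cong (_^ 3) hv) (cube-2^a3^k a k)) ⟨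
    63 ^ 3 * (1 + y) ^ 3        ≤⟨ *-cube-mono-≤ 63 (1 + y) 64 y (m*[1+n]≤[1+m]*n 63 63≤y) ⟩
    64 ^ 3 * y ^ 3              ∎
    where
    63≤y : 63 ≤ y
    63≤y = ≤-pred (subst (64 ≤_) (sym hv) (64≤2^a3^k k 6≤a))

5*[m+n]≤3*[m*n] : ∀ {m n} → 2 ≤ m → 2 ≤ n → 12 ≤ m + n → 5 * (m + n) ≤ 3 * (m * n)
5*[m+n]≤3*[m*n] {x@(suc (suc p))} {y@(suc (suc q))} (s≤s (s≤s z≤n)) (s≤s (s≤s z≤n)) 12≤x+y =
  +-cancelʳ-≤ 8 (5 * (x + y)) (3 * (x * y)) (begin
    5 * (x + y) + 8                   ≤⟨ +-monoʳ-≤ (5 * (x + y)) (≤-trans 8≤p+q (m≤m+n (p + q) (3 * (p * q)))) ⟩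
    5 * (x + y) + (p + q + 3 * (p * q)) ≡⟨ identity p q ⟩
    3 * (x * y) + 8                   ∎)
  where
  identity : ∀ p q → 5 * ((2 + p) + (2 + q)) + (p + q + 3 * (p * q)) ≡ 3 * ((2 + p) * (2 + q)) + 8
  identity = solve-∀
  8≤p+q : 8 ≤ p + q
  8≤p+q = +-cancelˡ-≤ 4 8 (p + q) (subst (12 ≤_) (sum-shift p q) 12≤x+y)
    where
    sum-shift : ∀ p q → (2 + p) + (2 + q) ≡ 4 + (p + q)
    sum-shift = solve-∀

27*9^a<375*8^a : ∀ {a} → a < 22 → 27 * 9 ^ a < 375 * 8 ^ a
27*9^a<375*8^a = from-yes (allUpTo? (λ a → 27 * 9 ^ a <? 375 * 8 ^ a) 22)

two-plus-absurd : ∀ a k {x y c d} → 6 ≤ a → a ≤ 21 → 2 ≤ x → 2 ≤ y → x + y ≡ 2 ^ a * 3 ^ k →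
                  x ^ 3 ≤ 3 ^ c → y ^ 3 ≤ 3 ^ d → c + d < 2 * a + 3 * k → ⊥
two-plus-absurd a k {x} {y} {c} {d} 6≤a a≤21 2≤x 2≤y hv x³≤ y³≤ c+d< =
  <⇒≱ (27*9^a<375*8^a (s≤s a≤21)) (cube-below-3^ a k 125 27 bound c+d<)
  where
  12≤x+y : 12 ≤ x + y
  12≤x+y = ≤-trans (m≤m+n 12 52) (subst (64 ≤_) (sym hv) (64≤2^a3^k k 6≤a))
  bound : 125 * (2 ^ a * 3 ^ k) ^ 3 ≤ 27 * 3 ^ (c + d)
  bound = begin
    125 * (2 ^ a * 3 ^ k) ^ 3  ≡⟨ cong (λ n → 125 * n ^ 3) hv ⟨
    5 ^ 3 * (x + y) ^ 3        ≤⟨ *-cube-mono-≤ 5 (x + y) 3 (x * y) (5*[m+n]≤3*[m*n] 2≤x 2≤y 12≤x+y) ⟩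
    3 ^ 3 * (x * y) ^ 3        ≡⟨ cong (27 *_) (^-distribʳ-* x y 3) ⟩
    27 * (x ^ 3 * y ^ 3)       ≤⟨ *-monoʳ-≤ 27 (*≤3^+ c d x³≤ y³≤) ⟩
    27 * 3 ^ (c + d)           ∎

open Summand

one-plus-absurd : ∀ a k {y c d} → 6 ≤ a → a ≤ 21 → 1 + y ≡ 2 ^ a * 3 ^ k → 1 ≤ c → Summand y d →
                  c + d < 2 * a + 3 * k → ⊥
one-plus-absurd a k {d = d} 6≤a a≤21 hv 1≤c sy c+d< =
  1+2^≤2·3^≢2^a3^k k (classified sy (lowDefect-pred a k 6≤a a≤21 hv 2+d≤)) (≤-trans (m≤m+n 3 3) 6≤a) hv
  where
  2+d≤ : 2 + d ≤ 2 * a + 3 * k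
  2+d≤ = ≤-trans (s≤s (+-monoˡ-≤ d 1≤c)) c+d<

short-sum-absurd : ∀ a k {x y c d} → 6 ≤ a → a ≤ 21 → x + y ≡ 2 ^ a * 3 ^ k → Summand x c → Summand y d →
                   c + d < 2 * a + 3 * k → ⊥
short-sum-absurd a k {x = zero} _ _ _ sx _ _ = n≮0 (positive sx)
short-sum-absurd a k {x = suc zero} 6≤a a≤21 hv sx sy c+d< = one-plus-absurd a k 6≤a a≤21 hv (cost-positive sx) sy c+d<
short-sum-absurd a k {x = suc (suc _)} {y = zero} _ _ _ _ sy _ = n≮0 (positive sy)
short-sum-absurd a k {x = x@(suc (suc _))} {y = suc zero} {c} {d} 6≤a a≤21 hv sx sy c+d< =
  one-plus-absurd a k 6≤a a≤21 (trans (+-comm 1 x) hv) (cost-positive sy) sx (subst (_< 2 * a + 3 * k) (+-comm c d) c+d<)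
short-sum-absurd a k {x = suc (suc _)} {y = suc (suc _)} {c} {d} 6≤a a≤21 hv sx sy c+d< =
  two-plus-absurd a k {c = c} {d} 6≤a a≤21 (s≤s (s≤s z≤n)) (s≤s (s≤s z≤n)) hv (selfridge sx) (selfridge sy) c+d<

ones-+-lower : ∀ a k {x y c d} → 6 ≤ a → a ≤ 21 → x + y ≡ 2 ^ a * 3 ^ k → Summand x c → Summand y d →
               2 * a + 3 * k ≤ c + d
ones-+-lower a k 6≤a a≤21 hv sx sy = ≮⇒≥ (short-sum-absurd a k 6≤a a≤21 hv sx sy)

prime-split : ∀ {p} → Prime p → ∀ {x y N} → x * y ≡ p * N →
              (∃[ x′ ] x ≡ p * x′ × x′ * y ≡ N) ⊎ (∃[ y′ ] y ≡ p * y′ × x * y′ ≡ N)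
prime-split {p} pp {x} {y} {N} eq with euclidsLemma x y pp (divides N (trans eq (*-comm p N)))
... | inj₁ (divides x′ x≡x′p) = inj₁ (x′ , x≡px′ , *-cancelˡ-≡ (x′ * y) N p {{prime⇒nonZero pp}} (begin-equality
  p * (x′ * y)  ≡⟨ *-assoc p x′ y ⟨
  p * x′ * y    ≡⟨ cong (_* y) x≡px′ ⟨
  x * y         ≡⟨ eq ⟩
  p * N         ∎))
  where
  x≡px′ : x ≡ p * x′
  x≡px′ = trans x≡x′p (*-comm x′ p)
... | inj₂ (divides y′ y≡y′p) = inj₂ (y′ , y≡py′ , *-cancelˡ-≡ (x * y′) N p {{prime⇒nonZero pp}} (begin-equality
  p * (x * y′)  ≡⟨ x∙yz≈y∙xz p x y′ ⟩
  x * (p * y′)  ≡⟨ cong (x *_) y≡py′ ⟨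
  x * y         ≡⟨ eq ⟩
  p * N         ∎))
  where
  y≡py′ : y ≡ p * y′
  y≡py′ = trans y≡y′p (*-comm y′ p)

prime^-split : ∀ {p} → Prime p → ∀ a {x y M} → x * y ≡ p ^ a * M →
  ∃[ a₁ ] ∃[ a₂ ] ∃[ x′ ] ∃[ y′ ] a₁ + a₂ ≡ a × x ≡ p ^ a₁ * x′ × y ≡ p ^ a₂ * y′ × x′ * y′ ≡ M
prime^-split pp zero {x} {y} eq =
  0 , 0 , x , y , refl , sym (*-identityˡ x) , sym (*-identityˡ y) , trans eq (*-identityˡ _)
prime^-split {p} pp (suc a) {M = M} eq with prime-split pp (trans eq (*-assoc p (p ^ a) M))
... | inj₁ (x₀ , x≡px₀ , eq₀) with prime^-split pp a eq₀
...   | a₁ , a₂ , x′ , y′ , sum , x₀≡ , y≡ , eq′ =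
  suc a₁ , a₂ , x′ , y′ , cong suc sum , trans x≡px₀ (trans (cong (p *_) x₀≡) (sym (*-assoc p (p ^ a₁) x′))) , y≡ , eq′
prime^-split {p} pp (suc a) {M = M} eq | inj₂ (y₀ , y≡py₀ , eq₀) with prime^-split pp a eq₀
...   | a₁ , a₂ , x′ , y′ , sum , x≡ , y₀≡ , eq′ =
  a₁ , suc a₂ , x′ , y′ , trans (+-suc a₁ a₂) (cong suc sum) , x≡ , trans y≡py₀ (trans (cong (p *_) y₀≡) (sym (*-assoc p (p ^ a₂) y′))) , eq′

factorise-2^a3^k : ∀ a k {x y} → x * y ≡ 2 ^ a * 3 ^ k →
  ∃[ a₁ ] ∃[ a₂ ] ∃[ k₁ ] ∃[ k₂ ] a₁ + a₂ ≡ a × k₁ + k₂ ≡ k × x ≡ 2 ^ a₁ * 3 ^ k₁ × y ≡ 2 ^ a₂ * 3 ^ k₂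
factorise-2^a3^k a k eq with prime^-split (from-yes (prime? 2)) a eq
... | a₁ , a₂ , x′ , y′ , sa , x≡ , y≡ , eq′ with prime^-split (from-yes (prime? 3)) k (trans eq′ (sym (*-identityʳ (3 ^ k))))
...   | k₁ , k₂ , x″ , y″ , sk , x′≡ , y′≡ , eq″ =
  a₁ , a₂ , k₁ , k₂ , sa , sk ,
  trans x≡ (cong (2 ^ a₁ *_) (trans x′≡ (trans (cong (3 ^ k₁ *_) (m*n≡1⇒m≡1 x″ y″ eq″)) (*-identityʳ _)))) ,
  trans y≡ (cong (2 ^ a₂ *_) (trans y′≡ (trans (cong (3 ^ k₂ *_) (m*n≡1⇒n≡1 x″ y″ eq″)) (*-identityʳ _))))

ones-lower : ∀ e a k → a ≤ 21 → val e ≡ 2 ^ a * 3 ^ k → 2 * a + 3 * k ≤ ones e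
ones-lower e a k a≤21 hv with a ≤? 5
... | yes a≤5 = ones-lower-small e a k (≤-trans a≤5 (m≤m+n 5 4)) hv
ones-lower one a k _ hv | no a≰5 =
  ⊥-elim (<⇒≱ (s≤s (s≤s z≤n)) (subst (64 ≤_) (sym hv) (64≤2^a3^k k (≰⇒> a≰5))))
ones-lower (e ⊕ f) a k a≤21 hv | no a≰5 = ones-+-lower a k (≰⇒> a≰5) a≤21 hv (summand e) (summand f)
ones-lower (e ⊗ f) a k a≤21 hv | no _ with factorise-2^a3^k a k {val e} {val f} hv
... | a₁ , a₂ , k₁ , k₂ , refl , refl , hv₁ , hv₂ = subst (_≤ ones e + ones f) (cost-+ a₁ a₂ k₁ k₂)
  (+-mono-≤ (ones-lower e a₁ k₁ (≤-trans (m≤m+n a₁ a₂) a≤21) hv₁) (ones-lower f a₂ k₂ (≤-trans (m≤n+m a₂ a₁) a≤21) hv₂))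
  where
  cost-+ : ∀ a₁ a₂ k₁ k₂ → (2 * a₁ + 3 * k₁) + (2 * a₂ + 3 * k₂) ≡ 2 * (a₁ + a₂) + 3 * (k₁ + k₂)
  cost-+ = solve-∀

mul-pow : Expr → Expr → ℕ → Expr
mul-pow e b zero    = e
mul-pow e b (suc n) = mul-pow e b n ⊗ b

val-mul-pow : ∀ e b n → val (mul-pow e b n) ≡ val e * val b ^ n
val-mul-pow e b zero    = sym (*-identityʳ (val e))
val-mul-pow e b (suc n) = begin-equality
  val (mul-pow e b n) * val b    ≡⟨ cong (_* val b) (val-mul-pow e b n) ⟩
  val e * val b ^ n * val b      ≡⟨ *-assoc (val e) (val b ^ n) (val b) ⟩
  val e * (val b ^ n * val b)    ≡⟨ cong (val e *_) (*-comm (val b ^ n) (val b)) ⟩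
  val e * val b ^ suc n          ∎

ones-mul-pow : ∀ e b n → ones (mul-pow e b n) ≡ ones e + n * ones b
ones-mul-pow e b zero    = sym (+-identityʳ (ones e))
ones-mul-pow e b (suc n) = begin-equality
  ones (mul-pow e b n) + ones b  ≡⟨ cong (_+ ones b) (ones-mul-pow e b n) ⟩
  ones e + n * ones b + ones b   ≡⟨ +-assoc (ones e) (n * ones b) (ones b) ⟩
  ones e + (n * ones b + ones b) ≡⟨ cong (ones e +_) (+-comm (n * ones b) (ones b)) ⟩
  ones e + suc n * ones b        ∎

two three : Expr
two   = one ⊕ one
three = one ⊕ two

expr-2^a3^k : ∀ a k → 1 ≤ a + k → Σ Expr λ e → val e ≡ 2 ^ a * 3 ^ k × ones e ≡ 2 * a + 3 * k
expr-2^a3^k zero    zero    ()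
expr-2^a3^k zero    (suc k) _ = mul-pow three three k ,
  trans (val-mul-pow three three k) (sym (*-identityˡ (3 ^ suc k))) ,
  trans (ones-mul-pow three three k) (cost k)
  where
  cost : ∀ k → 3 + k * 3 ≡ 2 * 0 + 3 * suc k
  cost = solve-∀
expr-2^a3^k (suc a) k       _ = mul-pow (mul-pow two two a) three k ,
  trans (val-mul-pow (mul-pow two two a) three k) (cong (_* 3 ^ k) (val-mul-pow two two a)) ,
  trans (trans (ones-mul-pow (mul-pow two two a) three k) (cong (_+ k * 3) (ones-mul-pow two two a))) (cost a k)
  where
  cost : ∀ a k → 2 + a * 2 + k * 3 ≡ 2 * suc a + 3 * k
  cost = solve-∀

theorem1p7 : (a k : ℕ) → a ≤ 21 → 1 ≤ a + k →
    IsComplexity (2 ^ a * 3 ^ k) (2 * a + 3 * k)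
theorem1p7 a k a≤21 1≤a+k = expr-2^a3^k a k 1≤a+k , λ e hv → ones-lower e a k a≤21 hv
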